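{- Let $g \geq 1$ and $x$ be integers, let $G = K_{(g:x)}$ with parts $G_0,\dots,G_{x-1}$, and let $(i_1,i_2,\dots,i_x)$ be an $x$-cycle through all the part indices. Let $(d_1,\dots,d_x)$ be a list of elements of $\mathbb{Z}_g$, let $d \equiv \sum_{k=1}^x d_k \pmod g$ (with $d \in \{0,\dots,g-1\}$), and let $h = \gcd(d,g)$. Then the graph $G[\Delta]$ consists of $h$ connected components, and each component is (1) a cycle of length $\frac{g}{h}x$ if $d \neq \frac{g}{2}$, and (2) a cycle of length $2x$ if $d = \frac{g}{2}$.
   Context: $K_{(g:x)}$ denotes the complete equipartite graph with $x$ parts of size $g$; its part $G_i$ has vertex set $\{(i,j) : j \in \mathbb{Z}_g\}$, and two vertices are adjacent iff they lie in different parts. For the given cycle $(i_1,\dots,i_x)$ (indices of $i$ taken cyclically, $i_{x+1} = i_1$) and differences $d_k$, let $D_k = \{\{(i_k,j),(i_{k+1},j+d_k)\} : j \in \mathbb{Z}_g\}$ be the set of edges from $G_{i_k}$ to $G_{i_{k+1}}$ with cross difference $d_k$, let $\Delta = (D_1,\dots,D_x)$, and let $G[\Delta]$ be the subgraph of $G$ induced by the edge set $D_1 \cup \dots \cup D_x$. Here $\gcd(0,g) = g$. -}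

module Defs where

open import Data.Nat using (ℕ; zero; suc; _+_; _*_; NonZero; ≢-nonZero; ≢-nonZero⁻¹)
open import Data.Nat.DivMod using (_%_; _/_)
open import Data.Nat.GCD using (gcd; gcd[m,n]≢0)
open import Data.Fin using (Fin; toℕ)
open import Data.Fin.Permutation using (Permutation′; _⟨$⟩ʳ_)
open import Data.List using (map; allFin)
open import Data.Nat.ListAction using (sum)
open import Data.Product using (Σ; ∃; _×_; _,_)
open import Data.Sum using (_⊎_; inj₂)
open import Function.Bundles using (_⇔_)
open import Relation.Binary.PropositionalEquality using (_≡_)
open import Relation.Binary.Construct.Closure.ReflexiveTransitive using (Star)

CycSucc : (L : ℕ) → Fin L → Fin L → Set
CycSucc L p q = (suc (toℕ p) ≡ toℕ q) ⊎ ((suc (toℕ p) ≡ L) × (toℕ q ≡ 0))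

CycAdj : (L : ℕ) → Fin L → Fin L → Set
CycAdj L p q = CycSucc L p q ⊎ CycSucc L q p

-- Vertices of K_(g:x): (i , j) with part index i : Fin x and j ∈ ℤ_g (= Fin g).
Vertex : ℕ → ℕ → Set
Vertex g x = Fin x × Fin g

-- The x-cycle (i_1,…,i_x) is given by the permutation σ : positions → part indices,
-- position k (0-based) ↦ i_{k+1}; the next position after k is k+1 mod x.
-- ds k is the difference d_{k+1} used on the edges from part σ k to the next part.
DirEdge : (g x : ℕ) .{{_ : NonZero g}} → Permutation′ x → (Fin x → Fin g) →
          Vertex g x → Vertex g x → Set
DirEdge g x σ ds (i , j) (i' , j') =
  Σ (Fin x) λ k → Σ (Fin x) λ k' →
    CycSucc x k k' × (i ≡ σ ⟨$⟩ʳ k) × (i' ≡ σ ⟨$⟩ʳ k') ×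
    (toℕ j' ≡ (toℕ j + toℕ (ds k)) % g)

Adj : (g x : ℕ) .{{_ : NonZero g}} → Permutation′ x → (Fin x → Fin g) →
      Vertex g x → Vertex g x → Set
Adj g x σ ds u v = DirEdge g x σ ds u v ⊎ DirEdge g x σ ds v u

dsum : (g x : ℕ) .{{_ : NonZero g}} → (Fin x → Fin g) → ℕ
dsum g x ds = sum (map (λ k → toℕ (ds k)) (allFin x)) % g

-- (g / h) * x where h = gcd(d, g)  (h ≠ 0 since g ≠ 0).
cycLen : (g x d : ℕ) .{{_ : NonZero g}} → ℕ
cycLen g x d = (_/_ g (gcd d g) {{≢-nonZero (gcd[m,n]≢0 d g (inj₂ (≢-nonZero⁻¹ g)))}}) * x

-- "The graph (V, Adj) consists of exactly h connected components, each of which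
-- (as an induced subgraph) is a cycle of length L."
-- comp labels the connected components (classes of the reflexive-transitive
-- closure of Adj) bijectively by Fin h; enum a enumerates component a as
-- v_0,…,v_{L-1} with distinct entries, and adjacency inside the component is
-- exactly that of the cycle C_L.
record CycleComponents {V : Set} (A : V → V → Set) (h L : ℕ) : Set where
  field
    comp          : V → Fin h
    comp-surj     : ∀ a → ∃ λ v → comp v ≡ a
    comp-sound    : ∀ u v → comp u ≡ comp v → Star A u v
    comp-complete : ∀ u v → Star A u v → comp u ≡ comp v
    enum          : Fin h → Fin L → V
    enum-inj      : ∀ a p q → enum a p ≡ enum a q → p ≡ q
    enum-in       : ∀ a p → comp (enum a p) ≡ a
    enum-onto     : ∀ v → ∃ λ p → enum (comp v) p ≡ v
    enum-adj      : ∀ a p q → A (enum a p) (enum a q) ⇔ CycAdj L p q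

-- Following Δ from (σ 0 , a) runs through the parts σ 0 , σ 1 , … , σ (x-1) , σ 0 , … and adds
-- d_{k+1} to the second coordinate on leaving part σ k, so after n steps it is at
-- (σ (n mod x) , a + W n), where W is the prefix sum of the periodically repeated differences.
-- Each round adds d₁ + ⋯ + d_x ≡ d, whose order in ℤ_g is m = g / h, so the walk closes up after
-- exactly L = m x steps without repeating a vertex. The walks from a = 0 , … , h - 1 are
-- disjoint: in part σ r, walk a only meets second coordinates ≡ a + W r (mod h), as h divides
-- both d and g. Hence the h L = x g vertices of these walks exhaust the graph, and since every
-- vertex has exactly one outgoing edge in Δ, each walk is a connected component inducing an
-- L-cycle. When 2 d = g, h = d and so m = 2.
module Submission where

open import Defs
open import Data.Nat using (ℕ; zero; suc; _+_; _*_; _≤_; _<_; NonZero; ≢-nonZero; ≢-nonZero⁻¹; >-nonZero; s≤s; z≤n)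
open import Data.Nat.Properties
open import Data.Nat.DivMod
open import Data.Nat.Divisibility using (_∣_; divides; ∣-refl; ∣-antisym; ∣n⇒∣m*n; m∣n*o⇒m/n∣o; m%n≡0⇒n∣m; >⇒∤)
open import Data.Nat.GCD using (gcd; gcd[m,n]∣m; gcd[m,n]∣n; gcd[m,n]≢0; gcd-greatest; n/gcd[m,n]≢0)
open import Data.Nat.Coprimality using (coprime-/gcd; coprime-divisor)
import Data.Nat.Coprimality as Coprime
open import Data.Nat.ListAction using (sum)
open import Data.Nat.ListAction.Properties using (sum-++)
open import Data.Nat.Tactic.RingSolver using (solve-∀)
open import Algebra.Properties.CommutativeSemigroup +-commutativeSemigroup using (xy∙z≈xz∙y; x∙yz≈yx∙z)
open import Data.Fin using (Fin; toℕ; fromℕ; inject₁; punchOut; combine; remQuot) renaming (zero to fzero; suc to fsuc)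
open import Data.Fin.Properties using (toℕ-injective; toℕ-fromℕ<; toℕ-fromℕ; toℕ-inject₁; toℕ<n; any?; pigeonhole; punchOut-injective; combine-injective; combine-remQuot) renaming (_≟_ to _≟ᶠ_; <⇒≢ to <⇒≢ᶠ)
open import Data.Fin.Induction using (<-weakInduction; >-weakInduction)
open import Data.Fin.Permutation using (Permutation′; _⟨$⟩ʳ_)
open import Data.List using (_∷_; [_]; _∷ʳ_; map; tabulate; applyUpTo; allFin)
open import Data.List.Properties using (applyUpTo-∷ʳ; map-tabulate)
open import Data.Product using (_×_; _,_; proj₁; proj₂; ∃; ∃₂; uncurry)
open import Data.Sum using (_⊎_; inj₁; inj₂; [_,_]′)
import Data.Sum as Sum
import Data.Product as Product
open import Function.Base using (_∘_)
open import Function.Bundles using (mk⇔; Injection)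
open import Function.Properties.Inverse using (↔⇒↣)
open import Relation.Nullary using (¬_; yes; no; contradiction)
open import Relation.Binary.PropositionalEquality using (_≡_; refl; sym; trans; cong; cong₂; subst; subst₂; module ≡-Reasoning)
open import Relation.Binary.Construct.Closure.ReflexiveTransitive using (Star; ε; _◅_; _◅◅_)
import Relation.Binary.Construct.Closure.ReflexiveTransitive as Star

[m%d+n]%d≡[m+n]%d : ∀ m n d .{{_ : NonZero d}} → (m % d + n) % d ≡ (m + n) % d
[m%d+n]%d≡[m+n]%d m n d = begin
  (m % d + n) % d         ≡⟨ %-distribˡ-+ (m % d) n d ⟩
  (m % d % d + n % d) % d ≡⟨ cong (λ r → (r + n % d) % d) (m%n%n≡m%n m d) ⟩
  (m % d + n % d) % d     ≡⟨ %-distribˡ-+ m n d ⟨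
  (m + n) % d             ∎
  where open ≡-Reasoning

-- m ≡ m + k d = (k + m) + k (d - 1) (mod d), and the right-hand side only depends on (k + m) mod d.
%-cancelˡ-+ : ∀ k {m n d} .{{_ : NonZero d}} → (k + m) % d ≡ (k + n) % d → m % d ≡ n % d
%-cancelˡ-+ k {m} {n} {d@(suc d-1)} eq = begin
  m % d                       ≡⟨ [m+kn]%n≡m%n m k d ⟨
  (m + k * d) % d             ≡⟨ cong (_% d) (shift m k d-1) ⟩
  ((k + m) + k * d-1) % d     ≡⟨ [m%d+n]%d≡[m+n]%d (k + m) (k * d-1) d ⟨
  ((k + m) % d + k * d-1) % d ≡⟨ cong (λ r → (r + k * d-1) % d) eq ⟩
  ((k + n) % d + k * d-1) % d ≡⟨ [m%d+n]%d≡[m+n]%d (k + n) (k * d-1) d ⟩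
  ((k + n) + k * d-1) % d     ≡⟨ cong (_% d) (shift n k d-1) ⟨
  (n + k * d) % d             ≡⟨ [m+kn]%n≡m%n n k d ⟩
  n % d                       ∎
  where
  open ≡-Reasoning
  shift : ∀ o k d-1 → o + k * suc d-1 ≡ (k + o) + k * d-1
  shift = solve-∀

[m+k*n]%d≡[m+k*[n%d]]%d : ∀ m k n d .{{_ : NonZero d}} → (m + k * n) % d ≡ (m + k * (n % d)) % d
[m+k*n]%d≡[m+k*[n%d]]%d m k n d = begin
  (m + k * n) % d                         ≡⟨ cong (λ r → (m + k * r) % d) (m≡m%n+[m/n]*n n d) ⟩
  (m + k * (n % d + n / d * d)) % d       ≡⟨ cong (_% d) (regroup m k (n % d) (n / d) d) ⟩
  (m + k * (n % d) + k * (n / d) * d) % d ≡⟨ [m+kn]%n≡m%n (m + k * (n % d)) (k * (n / d)) d ⟩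
  (m + k * (n % d)) % d                   ∎
  where
  open ≡-Reasoning
  regroup : ∀ m k r q d → m + k * (r + q * d) ≡ m + k * r + k * q * d
  regroup = solve-∀

module _ {d : ℕ} .{{_ : NonZero d}} {m n : ℕ} where

  %≡%⇒mod≡mod : m % d ≡ n % d → m mod d ≡ n mod d
  %≡%⇒mod≡mod eq = toℕ-injective (trans (toℕ-fromℕ< _) (trans eq (sym (toℕ-fromℕ< _))))

  mod≡mod⇒%≡% : m mod d ≡ n mod d → m % d ≡ n % d
  mod≡mod⇒%≡% eq = trans (sym (toℕ-fromℕ< _)) (trans (cong toℕ eq) (toℕ-fromℕ< _))

n∣[n/gcd[m,n]]*m : ∀ m n .{{_ : NonZero (gcd m n)}} → n ∣ (n / gcd m n) * m
n∣[n/gcd[m,n]]*m m n = divides (m / gcd m n) (begin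
  n / gcd m n * m                       ≡⟨ cong (n / gcd m n *_) (m/n*n≡m (gcd[m,n]∣m m n)) ⟨
  n / gcd m n * (m / gcd m n * gcd m n) ≡⟨ regroup (n / gcd m n) (m / gcd m n) (gcd m n) ⟩
  m / gcd m n * (n / gcd m n * gcd m n) ≡⟨ cong (m / gcd m n *_) (m/n*n≡m (gcd[m,n]∣n m n)) ⟩
  m / gcd m n * n                       ∎)
  where
  open ≡-Reasoning
  regroup : ∀ a b c → a * (b * c) ≡ b * (a * c)
  regroup = solve-∀

n∣m*c⇒n/gcd[c,n]∣m : ∀ {m c n} .{{_ : NonZero (gcd c n)}} → n ∣ m * c → n / gcd c n ∣ m
n∣m*c⇒n/gcd[c,n]∣m {m} {c} {n} n∣m*c = coprime-divisor (Coprime.sym (coprime-/gcd c n))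
  (subst (n / gcd c n ∣_) (*-comm m (c / gcd c n)) (m∣n*o⇒m/n∣o (gcd[m,n]∣n c n) n∣[m*c/g]*g))
  where
  n∣[m*c/g]*g : n ∣ m * (c / gcd c n) * gcd c n
  n∣[m*c/g]*g = subst (n ∣_) (trans (cong (m *_) (sym (m/n*n≡m (gcd[m,n]∣m c n)))) (sym (*-assoc m _ _))) n∣m*c

m∣n∧n<m⇒n≡0 : ∀ {m n} → m ∣ n → n < m → n ≡ 0
m∣n∧n<m⇒n≡0 {n = zero}  _   _   = refl
m∣n∧n<m⇒n≡0 {n = suc _} m∣n n<m = contradiction m∣n (>⇒∤ n<m)

*-cancelʳ-% : ∀ {c n} .{{_ : NonZero n}} .{{_ : NonZero (gcd c n)}} {t t′} →
              t < n / gcd c n → t′ < n / gcd c n → t * c % n ≡ t′ * c % n → t ≡ t′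
*-cancelʳ-% {c} {n} {t} {t′} t< t′< eq =
  [ (λ t≤t′ → cancel t≤t′ t′< eq) , (λ t′≤t → sym (cancel t′≤t t< (sym eq))) ]′ (≤-total t t′)
  where
  cancel : ∀ {t t′} → t ≤ t′ → t′ < n / gcd c n → t * c % n ≡ t′ * c % n → t ≡ t′
  cancel {t} t≤t′ t+e< eq with m≤n⇒∃[o]m+o≡n t≤t′
  ... | e , refl = sym (trans (cong (t +_) e≡0) (+-identityʳ t))
    where
    e*c%n≡0 : e * c % n ≡ 0
    e*c%n≡0 = trans (sym (%-cancelˡ-+ (t * c) t*c+0≡t*c+e*c)) (m*n%n≡0 0 n)
      where
      t*c+0≡t*c+e*c = trans (cong (_% n) (+-identityʳ (t * c))) (trans eq (cong (_% n) (*-distribʳ-+ c t e)))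
    e≡0 : e ≡ 0
    e≡0 = m∣n∧n<m⇒n≡0 (n∣m*c⇒n/gcd[c,n]∣m (m%n≡0⇒n∣m (e * c) n e*c%n≡0)) (≤-<-trans (m≤n+m e t) t+e<)

[a+t*d]%n-injective : ∀ {d n} .{{_ : NonZero n}} .{{_ : NonZero (gcd d n)}} {a a′ t t′} →
                      a < gcd d n → a′ < gcd d n → t < n / gcd d n → t′ < n / gcd d n →
                      (a + t * d) % n ≡ (a′ + t′ * d) % n → a ≡ a′ × t ≡ t′
[a+t*d]%n-injective {d} {n} {a} {a′} {t} {t′} a< a′< t< t′< eq = a≡a′ , t≡t′
  where
  reduce : ∀ {a t} → a < gcd d n → (a + t * d) % n % gcd d n ≡ a
  reduce {a} {t} a< = begin
    (a + t * d) % n % gcd d n ≡⟨ m∣n⇒o%n%m≡o%m (gcd d n) n _ (gcd[m,n]∣n d n) ⟩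
    (a + t * d) % gcd d n     ≡⟨ %-remove-+ʳ a (∣n⇒∣m*n t (gcd[m,n]∣m d n)) ⟩
    a % gcd d n               ≡⟨ m<n⇒m%n≡m a< ⟩
    a                         ∎
    where open ≡-Reasoning
  a≡a′ : a ≡ a′
  a≡a′ = trans (sym (reduce {t = t} a<)) (trans (cong (_% gcd d n) eq) (reduce {t = t′} a′<))
  t≡t′ : t ≡ t′
  t≡t′ = *-cancelʳ-% t< t′< (%-cancelˡ-+ a {t * d} {t′ * d}
           (subst (λ b → (a + t * d) % n ≡ (b + t′ * d) % n) (sym a≡a′) eq))

2*m≡n⇒n/gcd[m,n]≡2 : ∀ {m n} .{{_ : NonZero n}} .{{_ : NonZero (gcd m n)}} → 2 * m ≡ n → n / gcd m n ≡ 2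
2*m≡n⇒n/gcd[m,n]≡2 {m} refl = begin
  2 * m / gcd m (2 * m) ≡⟨ /-congʳ gcd[m,2m]≡m ⟩
  2 * m / m             ≡⟨ m*n/n≡m 2 m ⟩
  2                     ∎
  where
  open ≡-Reasoning
  instance
    m≢0 : NonZero m
    m≢0 = m*n≢0⇒n≢0 2
  gcd[m,2m]≡m : gcd m (2 * m) ≡ m
  gcd[m,2m]≡m = ∣-antisym (gcd[m,n]∣m m (2 * m)) (gcd-greatest ∣-refl (divides 2 refl))

injective⇒surjective : ∀ {m n} (f : Fin m → Fin n) → (∀ {i j} → f i ≡ f j → i ≡ j) → n ≤ m →
                       ∀ y → ∃ λ i → f i ≡ y
injective⇒surjective {m} {suc n} f f-injective n<m y with any? (λ i → f i ≟ᶠ y)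
... | yes hit = hit
... | no miss with pigeonhole n<m (λ i → punchOut {i = y} (λ y≡fi → miss (i , sym y≡fi)))
... | i , j , i<j , same = contradiction (f-injective (punchOut-injective {i = y} {f i} {f j} _ _ same)) (<⇒≢ᶠ i<j)

prefixSum : (ℕ → ℕ) → ℕ → ℕ
prefixSum f zero    = 0
prefixSum f (suc n) = prefixSum f n + f n

prefixSum≡sum∘applyUpTo : ∀ f n → prefixSum f n ≡ sum (applyUpTo f n)
prefixSum≡sum∘applyUpTo f zero    = refl
prefixSum≡sum∘applyUpTo f (suc n) = begin
  prefixSum f n + f n               ≡⟨ cong (_+ f n) (prefixSum≡sum∘applyUpTo f n) ⟩
  sum (applyUpTo f n) + f n         ≡⟨ cong (sum (applyUpTo f n) +_) (+-identityʳ (f n)) ⟨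
  sum (applyUpTo f n) + sum [ f n ] ≡⟨ sum-++ (applyUpTo f n) [ f n ] ⟨
  sum (applyUpTo f n ∷ʳ f n)        ≡⟨ cong sum (applyUpTo-∷ʳ f n) ⟩
  sum (applyUpTo f (suc n))         ∎
  where open ≡-Reasoning

tabulate≡applyUpTo : ∀ {A : Set} {n} {F : Fin n → A} {f : ℕ → A} →
                     (∀ i → F i ≡ f (toℕ i)) → tabulate F ≡ applyUpTo f n
tabulate≡applyUpTo {n = zero}  F≗f = refl
tabulate≡applyUpTo {n = suc n} F≗f = cong₂ _∷_ (F≗f fzero) (tabulate≡applyUpTo (F≗f ∘ fsuc))

module _ {f : ℕ → ℕ} {p : ℕ} (f-periodic : ∀ i → f (i + p) ≡ f i) where

  prefixSum-+period : ∀ n → prefixSum f (n + p) ≡ prefixSum f n + prefixSum f p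
  prefixSum-+period zero    = refl
  prefixSum-+period (suc n) = begin
    prefixSum f (n + p) + f (n + p)     ≡⟨ cong₂ _+_ (prefixSum-+period n) (f-periodic n) ⟩
    prefixSum f n + prefixSum f p + f n ≡⟨ xy∙z≈xz∙y (prefixSum f n) (prefixSum f p) (f n) ⟩
    prefixSum f n + f n + prefixSum f p ∎
    where open ≡-Reasoning

  prefixSum-+periods : ∀ n t → prefixSum f (n + t * p) ≡ prefixSum f n + t * prefixSum f p
  prefixSum-+periods n zero    = trans (cong (prefixSum f) (+-identityʳ n)) (sym (+-identityʳ _))
  prefixSum-+periods n (suc t) = begin
    prefixSum f (n + (p + t * p))                       ≡⟨ cong (prefixSum f) (+-assoc n p (t * p)) ⟨
    prefixSum f (n + p + t * p)                         ≡⟨ prefixSum-+periods (n + p) t ⟩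
    prefixSum f (n + p) + t * prefixSum f p             ≡⟨ cong (_+ t * prefixSum f p) (prefixSum-+period n) ⟩
    prefixSum f n + prefixSum f p + t * prefixSum f p   ≡⟨ +-assoc (prefixSum f n) _ _ ⟩
    prefixSum f n + (prefixSum f p + t * prefixSum f p) ∎
    where open ≡-Reasoning

module _ {L : ℕ} .{{_ : NonZero L}} {p q : Fin L} where

  cycSucc⇒≡suc% : CycSucc L p q → toℕ q ≡ suc (toℕ p) % L
  cycSucc⇒≡suc% (inj₁ p+1≡q) = sym (trans (cong (_% L) p+1≡q) (m<n⇒m%n≡m (toℕ<n q)))
  cycSucc⇒≡suc% (inj₂ (p+1≡L , q≡0)) = trans q≡0 (sym (trans (cong (_% L) p+1≡L) (n%n≡0 L)))

  ≡suc%⇒cycSucc : toℕ q ≡ suc (toℕ p) % L → CycSucc L p q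
  ≡suc%⇒cycSucc q≡ with m≤n⇒m<n∨m≡n (toℕ<n p)
  ... | inj₁ p+1<L = inj₁ (sym (trans q≡ (m<n⇒m%n≡m p+1<L)))
  ... | inj₂ p+1≡L = inj₂ (p+1≡L , trans q≡ (trans (cong (_% L) p+1≡L) (n%n≡0 L)))

module _ {L : ℕ} .{{_ : NonZero L}} where

  cycSucc-functional : ∀ {p q q′ : Fin L} → CycSucc L p q → CycSucc L p q′ → q ≡ q′
  cycSucc-functional s s′ = toℕ-injective (trans (cycSucc⇒≡suc% s) (sym (cycSucc⇒≡suc% s′)))

  cycSucc-next : ∀ (p : Fin L) → CycSucc L p (suc (toℕ p) mod L)
  cycSucc-next p = ≡suc%⇒cycSucc (toℕ-fromℕ< _)

cycSucc-mod : ∀ {L} .{{_ : NonZero L}} n → CycSucc L (n mod L) (suc n mod L)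
cycSucc-mod {L} n = ≡suc%⇒cycSucc (begin
  toℕ (suc n mod L)       ≡⟨ toℕ-fromℕ< _ ⟩
  suc n % L               ≡⟨ cong (_% L) (+-comm 1 n) ⟩
  (n + 1) % L             ≡⟨ [m%d+n]%d≡[m+n]%d n 1 L ⟨
  (n % L + 1) % L         ≡⟨ cong (λ r → (r + 1) % L) (toℕ-fromℕ< _) ⟨
  (toℕ (n mod L) + 1) % L ≡⟨ cong (_% L) (+-comm (toℕ (n mod L)) 1) ⟩
  suc (toℕ (n mod L)) % L ∎)
  where open ≡-Reasoning

cycSucc-connected : ∀ {L} (p q : Fin L) → Star (CycSucc L) p q
cycSucc-connected {suc n} p q = toLast p ◅◅ wrap ◅ fromZero q
  where
  step : ∀ i → CycSucc (suc n) (inject₁ i) (fsuc i)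
  step i = inj₁ (cong suc (toℕ-inject₁ i))
  toLast : ∀ i → Star (CycSucc (suc n)) i (fromℕ n)
  toLast = >-weakInduction _ ε (λ i s → step i ◅ s)
  wrap : CycSucc (suc n) (fromℕ n) fzero
  wrap = inj₂ (cong suc (toℕ-fromℕ n) , refl)
  fromZero : ∀ i → Star (CycSucc (suc n)) fzero i
  fromZero = <-weakInduction _ ε (λ i s → s ◅◅ step i ◅ ε)

module _ {V : Set} {R : V → V → Set} {h L : ℕ} .{{_ : NonZero L}}
         (enum : Fin h → Fin L → V)
         (enum-injective : ∀ {a p b q} → enum a p ≡ enum b q → a ≡ b × p ≡ q)
         (enum-surjective : ∀ v → ∃₂ λ a p → enum a p ≡ v)
         (R-functional : ∀ {u v w} → R u v → R u w → v ≡ w)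
         (R-cycSucc : ∀ a {p q} → CycSucc L p q → R (enum a p) (enum a q))
  where

  private
    _∼_ : V → V → Set
    u ∼ v = R u v ⊎ R v u

    comp : V → Fin h
    comp v = proj₁ (enum-surjective v)

    pos : V → Fin L
    pos v = proj₁ (proj₂ (enum-surjective v))

    enum-comp-pos : ∀ v → enum (comp v) (pos v) ≡ v
    enum-comp-pos v = proj₂ (proj₂ (enum-surjective v))

    comp-enum : ∀ a p → comp (enum a p) ≡ a
    comp-enum a p = proj₁ (enum-injective (enum-comp-pos (enum a p)))

    R⇒cycSucc : ∀ a {p q} → R (enum a p) (enum a q) → CycSucc L p q
    R⇒cycSucc a {p} r = subst (CycSucc L p) q′≡q (cycSucc-next p)
      where
      q′≡q = proj₂ (enum-injective (R-functional (R-cycSucc a (cycSucc-next p)) r))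

    R-comp : ∀ {u v} → R u v → comp u ≡ comp v
    R-comp {u} {v} r = begin
      comp u                    ≡⟨ comp-enum (comp u) next ⟨
      comp (enum (comp u) next) ≡⟨ cong comp (R-functional step (subst (λ w → R w v) (sym (enum-comp-pos u)) r)) ⟩
      comp v                    ∎
      where
      open ≡-Reasoning
      next = suc (toℕ (pos u)) mod L
      step = R-cycSucc (comp u) (cycSucc-next (pos u))

    ∼-comp : ∀ {u v} → u ∼ v → comp u ≡ comp v
    ∼-comp (inj₁ r) = R-comp r
    ∼-comp (inj₂ r) = sym (R-comp r)

    walk : ∀ a p q → Star _∼_ (enum a p) (enum a q)
    walk a p q = Star.gmap (enum a) (λ s → inj₁ (R-cycSucc a s)) (cycSucc-connected p q)

    comp-sound : ∀ u v → comp u ≡ comp v → Star _∼_ u v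
    comp-sound u v eq = subst₂ (Star _∼_) (enum-comp-pos u) enum-comp-pos′ (walk (comp u) (pos u) (pos v))
      where
      enum-comp-pos′ : enum (comp u) (pos v) ≡ v
      enum-comp-pos′ = trans (cong (λ a → enum a (pos v)) eq) (enum-comp-pos v)

  cycleComponents : CycleComponents _∼_ h L
  cycleComponents = record
    { comp          = comp
    ; comp-surj     = λ a → enum a (0 mod L) , comp-enum a _
    ; comp-sound    = comp-sound
    ; comp-complete = λ _ _ → Star.fold (λ u v → comp u ≡ comp v) (λ s eq → trans (∼-comp s) eq) refl
    ; enum          = enum
    ; enum-inj      = λ a p q eq → proj₂ (enum-injective eq)
    ; enum-in       = comp-enum
    ; enum-onto     = λ v → pos v , enum-comp-pos v
    ; enum-adj      = λ a p q → mk⇔ (Sum.map (R⇒cycSucc a) (R⇒cycSucc a)) (Sum.map (R-cycSucc a) (R-cycSucc a))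
    }

dirEdge-functional : ∀ {g x} .{{_ : NonZero g}} .{{_ : NonZero x}} (σ : Permutation′ x) (ds : Fin x → Fin g) {u v w} →
                     DirEdge g x σ ds u v → DirEdge g x σ ds u w → v ≡ w
dirEdge-functional σ ds (k , k′ , k→k′ , refl , refl , j′≡) (l , l′ , l→l′ , σk≡σl , refl , j″≡)
  with Injection.injective (↔⇒↣ σ) σk≡σl
... | refl = cong₂ _,_ (cong (σ ⟨$⟩ʳ_) (cycSucc-functional k→k′ l→l′)) (toℕ-injective (trans j′≡ (sym j″≡)))

module CycleWalk {g x : ℕ} .{{_ : NonZero g}} .{{_ : NonZero x}} (σ : Permutation′ x) (ds : Fin x → Fin g) where

  d h : ℕ
  d = dsum g x ds
  h = gcd d g

  instance
    h≢0 : NonZero h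
    h≢0 = ≢-nonZero (gcd[m,n]≢0 d g (inj₂ (≢-nonZero⁻¹ g)))

  m : ℕ
  m = g / h

  instance
    m≢0 : NonZero m
    m≢0 = ≢-nonZero (n/gcd[m,n]≢0 d g)

  L : ℕ
  L = m * x

  instance
    L≢0 : NonZero L
    L≢0 = m*n≢0 m x

  δ : ℕ → ℕ
  δ n = toℕ (ds (n mod x))

  W : ℕ → ℕ
  W = prefixSum δ

  vertex : ℕ → ℕ → Vertex g x
  vertex a n = σ ⟨$⟩ʳ (n mod x) , (a + W n) mod g

  d≡Wx%g : d ≡ W x % g
  d≡Wx%g = cong (_% g) (begin
    sum (map (toℕ ∘ ds) (allFin x)) ≡⟨ cong sum (map-tabulate (λ i → i) (toℕ ∘ ds)) ⟩
    sum (tabulate (toℕ ∘ ds))       ≡⟨ cong sum (tabulate≡applyUpTo (λ i → cong (toℕ ∘ ds) (sym (toℕ-mod i)))) ⟩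
    sum (applyUpTo δ x)             ≡⟨ prefixSum≡sum∘applyUpTo δ x ⟨
    W x                             ∎)
    where
    open ≡-Reasoning
    toℕ-mod : ∀ (i : Fin x) → toℕ i mod x ≡ i
    toℕ-mod i = toℕ-injective (trans (toℕ-fromℕ< _) (m<n⇒m%n≡m (toℕ<n i)))

  W-+periods : ∀ n t → W (n + t * x) ≡ W n + t * W x
  W-+periods = prefixSum-+periods (λ i → cong (toℕ ∘ ds) (%≡%⇒mod≡mod ([m+n]%n≡m%n i x)))

  W-+periods-% : ∀ b n t → (b + W (n + t * x)) % g ≡ (b + W n + t * d) % g
  W-+periods-% b n t = begin
    (b + W (n + t * x)) % g       ≡⟨ cong (λ w → (b + w) % g) (W-+periods n t) ⟩
    (b + (W n + t * W x)) % g     ≡⟨ cong (_% g) (+-assoc b (W n) _) ⟨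
    (b + W n + t * W x) % g       ≡⟨ [m+k*n]%d≡[m+k*[n%d]]%d (b + W n) t (W x) g ⟩
    (b + W n + t * (W x % g)) % g ≡⟨ cong (λ r → (b + W n + t * r) % g) d≡Wx%g ⟨
    (b + W n + t * d) % g         ∎
    where open ≡-Reasoning

  vertex-step : ∀ a n → DirEdge g x σ ds (vertex a n) (vertex a (suc n))
  vertex-step a n = n mod x , suc n mod x , cycSucc-mod n , refl , refl , (begin
    toℕ ((a + W (suc n)) mod g)       ≡⟨ toℕ-fromℕ< _ ⟩
    (a + (W n + δ n)) % g             ≡⟨ cong (_% g) (+-assoc a (W n) (δ n)) ⟨
    (a + W n + δ n) % g               ≡⟨ [m%d+n]%d≡[m+n]%d (a + W n) (δ n) g ⟨
    ((a + W n) % g + δ n) % g         ≡⟨ cong (λ r → (r + δ n) % g) (toℕ-fromℕ< _) ⟨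
    (toℕ ((a + W n) mod g) + δ n) % g ∎)
    where open ≡-Reasoning

  vertex-+periods : ∀ a n k → vertex a (n + k * L) ≡ vertex a n
  vertex-+periods a n k = cong₂ _,_ (cong (σ ⟨$⟩ʳ_) (%≡%⇒mod≡mod part)) (%≡%⇒mod≡mod value)
    where
    open ≡-Reasoning
    k*L≡k*m*x : k * L ≡ k * m * x
    k*L≡k*m*x = sym (*-assoc k m x)
    g∣k*m*d : g ∣ k * m * d
    g∣k*m*d = subst (g ∣_) (sym (*-assoc k m d)) (∣n⇒∣m*n k (n∣[n/gcd[m,n]]*m d g))
    part : (n + k * L) % x ≡ n % x
    part = trans (cong (λ r → (n + r) % x) k*L≡k*m*x) ([m+kn]%n≡m%n n (k * m) x)
    value : (a + W (n + k * L)) % g ≡ (a + W n) % g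
    value = begin
      (a + W (n + k * L)) % g     ≡⟨ cong (λ r → (a + W (n + r)) % g) k*L≡k*m*x ⟩
      (a + W (n + k * m * x)) % g ≡⟨ W-+periods-% a n (k * m) ⟩
      (a + W n + k * m * d) % g   ≡⟨ %-remove-+ʳ (a + W n) g∣k*m*d ⟩
      (a + W n) % g               ∎

  vertex-%L : ∀ a n → vertex a (n % L) ≡ vertex a n
  vertex-%L a n = trans (sym (vertex-+periods a (n % L) (n / L))) (cong (vertex a) (sym (m≡m%n+[m/n]*n n L)))

  W-%x : ∀ b n → (b + W n) % g ≡ (b + W (n % x) + n / x * d) % g
  W-%x b n = trans (cong (λ r → (b + W r) % g) (m≡m%n+[m/n]*n n x)) (W-+periods-% b (n % x) (n / x))

  vertex-injective : ∀ {a a′ n n′} → a < h → a′ < h → n < L → n′ < L →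
                     vertex a n ≡ vertex a′ n′ → a ≡ a′ × n ≡ n′
  vertex-injective {a} {a′} {n} {n′} a< a′< n< n′< eq = proj₁ a,t≡a′,t′ , n≡n′
    where
    open ≡-Reasoning
    r≡r′ : n % x ≡ n′ % x
    r≡r′ = mod≡mod⇒%≡% (Injection.injective (↔⇒↣ σ) (cong proj₁ eq))
    a+td≡a′+t′d : (a + n / x * d) % g ≡ (a′ + n′ / x * d) % g
    a+td≡a′+t′d = %-cancelˡ-+ (W (n % x)) (begin
      (W (n % x) + (a + n / x * d)) % g   ≡⟨ cong (_% g) (x∙yz≈yx∙z (W (n % x)) a _) ⟩
      (a + W (n % x) + n / x * d) % g     ≡⟨ W-%x a n ⟨
      (a + W n) % g                       ≡⟨ mod≡mod⇒%≡% (cong proj₂ eq) ⟩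
      (a′ + W n′) % g                     ≡⟨ W-%x a′ n′ ⟩
      (a′ + W (n′ % x) + n′ / x * d) % g  ≡⟨ cong (λ r → (a′ + W r + n′ / x * d) % g) r≡r′ ⟨
      (a′ + W (n % x) + n′ / x * d) % g   ≡⟨ cong (_% g) (x∙yz≈yx∙z (W (n % x)) a′ _) ⟨
      (W (n % x) + (a′ + n′ / x * d)) % g ∎)
    a,t≡a′,t′ : a ≡ a′ × n / x ≡ n′ / x
    a,t≡a′,t′ = [a+t*d]%n-injective a< a′< (m<n*o⇒m/o<n n<) (m<n*o⇒m/o<n n′<) a+td≡a′+t′d
    n≡n′ : n ≡ n′
    n≡n′ = begin
      n                   ≡⟨ m≡m%n+[m/n]*n n x ⟩
      n % x + n / x * x   ≡⟨ cong₂ (λ r t → r + t * x) r≡r′ (proj₂ a,t≡a′,t′) ⟩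
      n′ % x + n′ / x * x ≡⟨ m≡m%n+[m/n]*n n′ x ⟨
      n′                  ∎

  enum : Fin h → Fin L → Vertex g x
  enum a p = vertex (toℕ a) (toℕ p)

  enum-injective : ∀ {a p b q} → enum a p ≡ enum b q → a ≡ b × p ≡ q
  enum-injective {a} {p} {b} {q} eq =
    Product.map toℕ-injective toℕ-injective (vertex-injective (toℕ<n a) (toℕ<n b) (toℕ<n p) (toℕ<n q) eq)

  enum-cycSucc : ∀ a {p q} → CycSucc L p q → DirEdge g x σ ds (enum a p) (enum a q)
  enum-cycSucc a {p} {q} p→q = subst (DirEdge g x σ ds (enum a p)) next≡q (vertex-step (toℕ a) (toℕ p))
    where
    next≡q : vertex (toℕ a) (suc (toℕ p)) ≡ enum a q
    next≡q = trans (sym (vertex-%L (toℕ a) _)) (cong (vertex (toℕ a)) (sym (cycSucc⇒≡suc% p→q)))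

  h*L≡x*g : h * L ≡ x * g
  h*L≡x*g = begin
    h * (m * x) ≡⟨ regroup h m x ⟩
    x * (m * h) ≡⟨ cong (x *_) (m/n*n≡m (gcd[m,n]∣n d g)) ⟩
    x * g       ∎
    where
    open ≡-Reasoning
    regroup : ∀ h m x → h * (m * x) ≡ x * (m * h)
    regroup = solve-∀

  encode : Fin (h * L) → Fin (x * g)
  encode w = uncurry combine (uncurry enum (remQuot L w))

  encode-injective : ∀ {w w′} → encode w ≡ encode w′ → w ≡ w′
  encode-injective {w} {w′} eq = begin
    w                                  ≡⟨ combine-remQuot {h} L w ⟨
    uncurry combine (remQuot {h} L w)  ≡⟨ cong (uncurry combine) (uncurry (cong₂ _,_) a,p≡b,q) ⟩
    uncurry combine (remQuot {h} L w′) ≡⟨ combine-remQuot {h} L w′ ⟩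
    w′                                 ∎
    where
    open ≡-Reasoning
    a,p≡b,q = enum-injective (uncurry (cong₂ _,_) (combine-injective _ _ _ _ eq))

  enum-surjective : ∀ v → ∃₂ λ a p → enum a p ≡ v
  enum-surjective (i , j) = proj₁ (remQuot {h} L w) , proj₂ (remQuot {h} L w) ,
    uncurry (cong₂ _,_) (combine-injective _ _ _ _ (proj₂ preimage))
    where
    preimage = injective⇒surjective encode encode-injective (≤-reflexive (sym h*L≡x*g)) (combine i j)
    w = proj₁ preimage

lemma2 : (g x : ℕ) .{{_ : NonZero g}} → 2 ≤ x →
         (σ : Permutation′ x) → (ds : Fin x → Fin g) →
         (¬ (2 * dsum g x ds ≡ g) →
            CycleComponents (Adj g x σ ds) (gcd (dsum g x ds) g) (cycLen g x (dsum g x ds)))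
         × (2 * dsum g x ds ≡ g →
            CycleComponents (Adj g x σ ds) (gcd (dsum g x ds) g) (2 * x))
lemma2 g x 2≤x σ ds = (λ _ → components) , λ 2d≡g → subst (CycleComponents (Adj g x σ ds) h) (L≡2x 2d≡g) components
  where
  instance
    x≢0 : NonZero x
    x≢0 = >-nonZero (≤-trans (s≤s z≤n) 2≤x)
  open CycleWalk σ ds
  components : CycleComponents (Adj g x σ ds) h L
  components = cycleComponents {R = DirEdge g x σ ds}
    enum enum-injective enum-surjective (dirEdge-functional σ ds) enum-cycSucc
  L≡2x : 2 * d ≡ g → L ≡ 2 * x
  L≡2x 2d≡g = cong (_* x) (2*m≡n⇒n/gcd[m,n]≡2 {d} 2d≡g)
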